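{- Let $k\ge1$ be an integer, $\epsilon>0$, and let $f:\mathbb{Z}_2^n\to\mathbb{Z}_2$ be $\epsilon$-far from being linear. Then, for $x_1,\dots,x_{2k}\in\mathbb{Z}_2^n$ chosen uniformly and independently at random, $\Pr\left[f(x_1)+\cdots+f(x_{2k})=f(x_1+\cdots+x_{2k})\right]\le\tfrac12+\tfrac12(1-2\epsilon)^{2k-1}$.
   Context: A function is linear if it has the form $x\mapsto\sum_{i\in S}x_i$ over $\mathbb{Z}_2$ for some $S\subseteq[n]$. $f$ is $\epsilon$-far from being linear if $|\{x:f(x)\ne g(x)\}|\ge\epsilon2^n$ for every linear $g$. All additions are in $\mathbb{Z}_2$ (resp. $\mathbb{Z}_2^n$).
   Formalization: The parameter ε ranges over the positive rationals. -}

module Defs where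

open import Data.Bool using (Bool; true; false; _xor_; _∧_)
open import Data.Bool.Properties using () renaming (_≟_ to _≟ᵇ_)
open import Data.Nat using (ℕ; zero; suc)
open import Data.Integer using (+_)
open import Data.List using (List; []; _∷_; concatMap; map; filter; length)
open import Data.Vec using (Vec; []; _∷_; zipWith; replicate; foldr)
open import Data.Rational using (ℚ; _/_; _*_; 1ℚ)
open import Relation.Nullary using (¬?)

-- Z_2 is modelled by Bool with addition _xor_ ; Z_2^n by Vec Bool n.
Bits : ℕ → Set
Bits n = Vec Bool n

allSeqs : {A : Set} → (m : ℕ) → List A → List (Vec A m)
allSeqs zero    xs = [] ∷ []
allSeqs (suc m) xs = concatMap (λ a → map (a ∷_) (allSeqs m xs)) xs

allBits : (n : ℕ) → List (Bits n)
allBits n = allSeqs n (false ∷ true ∷ [])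

_⊕_ : {n : ℕ} → Bits n → Bits n → Bits n
_⊕_ = zipWith _xor_

𝟎 : {n : ℕ} → Bits n
𝟎 = replicate _ false

-- the linear function x ↦ Σ_{i∈S} x_i, with S ⊆ [n] given by its indicator vector
linear : {n : ℕ} → Bits n → Bits n → Bool
linear S x = foldr _ _xor_ false (zipWith _∧_ S x)

distance : {n : ℕ} → (Bits n → Bool) → (Bits n → Bool) → ℕ
distance {n} f g = length (filter (λ x → ¬? (f x ≟ᵇ g x)) (allBits n))

ℕ→ℚ : ℕ → ℚ
ℕ→ℚ c = + c / 1

_^ℚ_ : ℚ → ℕ → ℚ
q ^ℚ zero  = 1ℚ
q ^ℚ suc m = q * (q ^ℚ m)

EpsFarFromLinear : {n : ℕ} → ℚ → (Bits n → Bool) → Set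
EpsFarFromLinear {n} ε f =
  (S : Bits n) → ε * ℕ→ℚ (Data.Nat._^_ 2 n) Data.Rational.≤ ℕ→ℚ (distance f (linear S))

goodTuples : (n m : ℕ) → (Bits n → Bool) → ℕ
goodTuples n m f =
  length (filter (λ xs → foldr _ (λ x b → f x xor b) false xs ≟ᵇ f (foldr _ _⊕_ 𝟎 xs))
                 (allSeqs m (allBits n)))

-- Write F = (-1)^f, N = 2ⁿ, χ_S = (-1)^⟨S,·⟩ and F̂(S) = N⁻¹ ∑_x F(x) χ_S(x) = 1 − 2·dist(f, ⟨S,·⟩)/N,
-- which is at most 1 − 2ε since f is ε-far from linear. Expanding F in the characters turns
--   corr m F = ∑ F(x₁)⋯F(xₘ) F(x₁+⋯+xₘ)   into   N^m ∑_S F̂(S)^(m+1).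
-- For m = 2k the exponent 2k − 1 is odd, so x ↦ x^(2k−1) is monotone and
-- F̂(S)^(2k+1) ≤ (1 − 2ε)^(2k−1) F̂(S)²; with Parseval, ∑_S F̂(S)² = 1, this gives
-- corr 2k F ≤ (1 − 2ε)^(2k−1) N^(2k). The number of good tuples is (corr 2k F + N^(2k)) / 2.

module Submission where

open import Defs
open import Data.Nat using (ℕ; _≤_; _∸_)
open import Data.Rational using (ℚ; _<_; _+_; _-_; _*_; 0ℚ; 1ℚ; ½)
open import Data.Bool using (Bool)

open import Algebra.Bundles using (CommutativeRing)
open import Data.Bool using (true; false; _xor_; _∧_)
open import Data.Bool.Properties using (_≟_; ∧-zeroʳ; ∧-distribˡ-xor; xor-∧-commutativeRing)
open import Algebra.Properties.CommutativeSemigroup (CommutativeRing.+-commutativeSemigroup xor-∧-commutativeRing)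
  using () renaming (interchange to xor-interchange)
import Data.Integer as ℤ
import Data.Integer.Properties as ℤₚ
open import Data.List using (List; []; _∷_; _++_; map; concatMap; filter; length)
open import Data.List.Properties using (length-++; length-map)
open import Data.Nat as ℕ using (zero; suc; _^_)
import Data.Nat.Properties as ℕₚ
open import Data.Rational as ℚ using (-_; toℚᵘ)
import Data.Rational.Properties as ℚₚ
open import Data.Rational.Solver using (module +-*-Solver)
open +-*-Solver using (solve; _:=_; _:+_; _:*_; _:-_; :-_; con)
import Data.Rational.Unnormalised as ℚᵘ
import Data.Rational.Unnormalised.Properties as ℚᵘₚ
open import Data.Sum using (inj₁; inj₂)
open import Data.Vec using (Vec; []; _∷_; foldr)
open import Relation.Nullary using (Dec; yes; no; ¬?)
open import Relation.Unary using (Pred; Decidable)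
open import Relation.Binary.PropositionalEquality

ℕ→ℚ≃mkℚᵘ : ∀ a → toℚᵘ (ℕ→ℚ a) ℚᵘ.≃ ℚᵘ.mkℚᵘ (ℤ.+ a) 0
ℕ→ℚ≃mkℚᵘ a = ℚₚ.toℚᵘ-fromℚᵘ (ℚᵘ.mkℚᵘ (ℤ.+ a) 0)

ℕ→ℚ-+ : ∀ a b → ℕ→ℚ (a ℕ.+ b) ≡ ℕ→ℚ a + ℕ→ℚ b
ℕ→ℚ-+ a b = ℚₚ.toℚᵘ-injective (ℚᵘₚ.≃-trans (ℕ→ℚ≃mkℚᵘ (a ℕ.+ b)) (ℚᵘₚ.≃-sym
  (ℚᵘₚ.≃-trans (ℚₚ.toℚᵘ-homo-+ (ℕ→ℚ a) (ℕ→ℚ b))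
  (ℚᵘₚ.≃-trans (ℚᵘₚ.+-cong (ℕ→ℚ≃mkℚᵘ a) (ℕ→ℚ≃mkℚᵘ b)) (ℚᵘ.*≡* cross)))))
  where
  cross : (ℤ.+ a ℤ.* ℤ.+ 1 ℤ.+ ℤ.+ b ℤ.* ℤ.+ 1) ℤ.* ℤ.+ 1 ≡ ℤ.+ (a ℕ.+ b) ℤ.* ℤ.+ 1
  cross = trans (ℤₚ.*-identityʳ _)
    (trans (cong₂ ℤ._+_ (ℤₚ.*-identityʳ (ℤ.+ a)) (ℤₚ.*-identityʳ (ℤ.+ b))) (sym (ℤₚ.*-identityʳ _)))

ℕ→ℚ-* : ∀ a b → ℕ→ℚ (a ℕ.* b) ≡ ℕ→ℚ a * ℕ→ℚ b
ℕ→ℚ-* a b = ℚₚ.toℚᵘ-injective (ℚᵘₚ.≃-trans (ℕ→ℚ≃mkℚᵘ (a ℕ.* b)) (ℚᵘₚ.≃-sym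
  (ℚᵘₚ.≃-trans (ℚₚ.toℚᵘ-homo-* (ℕ→ℚ a) (ℕ→ℚ b))
  (ℚᵘₚ.≃-trans (ℚᵘₚ.*-cong (ℕ→ℚ≃mkℚᵘ a) (ℕ→ℚ≃mkℚᵘ b)) (ℚᵘ.*≡* cross)))))
  where
  cross : (ℤ.+ a ℤ.* ℤ.+ b) ℤ.* ℤ.+ 1 ≡ ℤ.+ (a ℕ.* b) ℤ.* ℤ.+ 1
  cross = cong (ℤ._* ℤ.+ 1) (sym (ℤₚ.pos-* a b))

ℕ→ℚ-suc : ∀ a → ℕ→ℚ (suc a) ≡ 1ℚ + ℕ→ℚ a
ℕ→ℚ-suc = ℕ→ℚ-+ 1

ℕ→ℚ-^ : ∀ a m → ℕ→ℚ (a ^ m) ≡ ℕ→ℚ a ^ℚ m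
ℕ→ℚ-^ a zero    = refl
ℕ→ℚ-^ a (suc m) = trans (ℕ→ℚ-* a (a ^ m)) (cong (ℕ→ℚ a *_) (ℕ→ℚ-^ a m))

ℕ→ℚ-2^-* : ∀ m n → ℕ→ℚ (2 ^ (m ℕ.* n)) ≡ ℕ→ℚ (2 ^ n) ^ℚ m
ℕ→ℚ-2^-* m n = trans (cong ℕ→ℚ (trans (cong (2 ^_) (ℕₚ.*-comm m n)) (sym (ℕₚ.^-*-assoc 2 n m)))) (ℕ→ℚ-^ (2 ^ n) m)

ℕ→ℚ-2^-suc : ∀ n → ℕ→ℚ (2 ^ suc n) ≡ ℕ→ℚ (2 ^ n) + ℕ→ℚ (2 ^ n)
ℕ→ℚ-2^-suc n = trans (ℕ→ℚ-+ (2 ^ n) (2 ^ n ℕ.+ 0)) (cong (λ k → ℕ→ℚ (2 ^ n) + ℕ→ℚ k) (ℕₚ.+-identityʳ (2 ^ n)))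

ℕ→ℚ-2^-pos : ∀ n → 0ℚ ℚ.< ℕ→ℚ (2 ^ n)
ℕ→ℚ-2^-pos zero    = ℚₚ.positive⁻¹ 1ℚ
ℕ→ℚ-2^-pos (suc n) = subst (ℚ._< ℕ→ℚ (2 ^ suc n)) (ℚₚ.+-identityʳ 0ℚ)
  (subst (0ℚ + 0ℚ ℚ.<_) (sym (ℕ→ℚ-2^-suc n)) (ℚₚ.+-mono-< (ℕ→ℚ-2^-pos n) (ℕ→ℚ-2^-pos n)))

^ℚ-distrib-* : ∀ x y m → (x * y) ^ℚ m ≡ x ^ℚ m * y ^ℚ m
^ℚ-distrib-* x y zero    = refl
^ℚ-distrib-* x y (suc m) = trans (cong (x * y *_) (^ℚ-distrib-* x y m))
  (solve 4 (λ x y p q → (x :* y) :* (p :* q) := (x :* p) :* (y :* q)) refl x y (x ^ℚ m) (y ^ℚ m))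

^ℚ-nonNeg : ∀ {x} m → 0ℚ ℚ.≤ x → 0ℚ ℚ.≤ x ^ℚ m
^ℚ-nonNeg     zero    0≤x = ℚₚ.nonNegative⁻¹ 1ℚ
^ℚ-nonNeg {x} (suc m) 0≤x = ℚₚ.nonNegative⁻¹ (x * x ^ℚ m)
  {{ℚₚ.nonNeg*nonNeg⇒nonNeg x {{ℚ.nonNegative 0≤x}} (x ^ℚ m) {{ℚ.nonNegative (^ℚ-nonNeg m 0≤x)}}}}

^ℚ-mono-≤ : ∀ {x y} m → 0ℚ ℚ.≤ x → x ℚ.≤ y → x ^ℚ m ℚ.≤ y ^ℚ m
^ℚ-mono-≤         zero    0≤x x≤y = ℚₚ.≤-refl
^ℚ-mono-≤ {x} {y} (suc m) 0≤x x≤y = ℚₚ.≤-trans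
  (ℚₚ.*-monoʳ-≤-nonNeg (x ^ℚ m) {{ℚ.nonNegative (^ℚ-nonNeg m 0≤x)}} x≤y)
  (ℚₚ.*-monoˡ-≤-nonNeg y {{ℚ.nonNegative (ℚₚ.≤-trans 0≤x x≤y)}} (^ℚ-mono-≤ m 0≤x x≤y))

neg-^ℚ-even : ∀ x i → (- x) ^ℚ (2 ℕ.* i) ≡ x ^ℚ (2 ℕ.* i)
neg-^ℚ-even x zero    = refl
neg-^ℚ-even x (suc i) = begin
  (- x) ^ℚ (2 ℕ.* suc i)               ≡⟨ cong ((- x) ^ℚ_) (ℕₚ.*-suc 2 i) ⟩
  - x * (- x * (- x) ^ℚ (2 ℕ.* i))     ≡⟨ cong (λ p → - x * (- x * p)) (neg-^ℚ-even x i) ⟩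
  - x * (- x * x ^ℚ (2 ℕ.* i))         ≡⟨ solve 2 (λ x p → (:- x) :* ((:- x) :* p) := x :* (x :* p)) refl x (x ^ℚ (2 ℕ.* i)) ⟩
  x * (x * x ^ℚ (2 ℕ.* i))             ≡⟨ cong (x ^ℚ_) (ℕₚ.*-suc 2 i) ⟨
  x ^ℚ (2 ℕ.* suc i)                   ∎
  where open ≡-Reasoning

^ℚ-odd-via-neg : ∀ x i → x ^ℚ suc (2 ℕ.* i) ≡ - (- x) ^ℚ suc (2 ℕ.* i)
^ℚ-odd-via-neg x i = trans (solve 2 (λ x p → x :* p := :- ((:- x) :* p)) refl x (x ^ℚ (2 ℕ.* i)))
  (cong (λ p → - ((- x) * p)) (sym (neg-^ℚ-even x i)))

^ℚ-odd-nonPos : ∀ i {x} → x ℚ.≤ 0ℚ → x ^ℚ suc (2 ℕ.* i) ℚ.≤ 0ℚ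
^ℚ-odd-nonPos i {x} x≤0 = subst (ℚ._≤ 0ℚ) (sym (^ℚ-odd-via-neg x i))
  (ℚₚ.neg-antimono-≤ (^ℚ-nonNeg (suc (2 ℕ.* i)) (ℚₚ.neg-antimono-≤ x≤0)))

^ℚ-odd-mono-≤ : ∀ i {x y} → x ℚ.≤ y → x ^ℚ suc (2 ℕ.* i) ℚ.≤ y ^ℚ suc (2 ℕ.* i)
^ℚ-odd-mono-≤ i {x} {y} x≤y with ℚₚ.≤-total 0ℚ x | ℚₚ.≤-total 0ℚ y
... | inj₁ 0≤x | _        = ^ℚ-mono-≤ (suc (2 ℕ.* i)) 0≤x x≤y
... | inj₂ x≤0 | inj₁ 0≤y = ℚₚ.≤-trans (^ℚ-odd-nonPos i x≤0) (^ℚ-nonNeg (suc (2 ℕ.* i)) 0≤y)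
... | inj₂ x≤0 | inj₂ y≤0 = subst₂ ℚ._≤_ (sym (^ℚ-odd-via-neg x i)) (sym (^ℚ-odd-via-neg y i))
  (ℚₚ.neg-antimono-≤ (^ℚ-mono-≤ (suc (2 ℕ.* i)) (ℚₚ.neg-antimono-≤ y≤0) (ℚₚ.neg-antimono-≤ x≤y)))

square-nonNeg : ∀ x → ℚ.NonNegative (x * x)
square-nonNeg x with ℚₚ.≤-total 0ℚ x
... | inj₁ 0≤x = ℚₚ.nonNeg*nonNeg⇒nonNeg x {{ℚ.nonNegative 0≤x}} x {{ℚ.nonNegative 0≤x}}
... | inj₂ x≤0 = ℚₚ.nonPos*nonPos⇒nonPos x {{ℚ.nonPositive x≤0}} x {{ℚ.nonPositive x≤0}}

∑ : {A : Set} → List A → (A → ℚ) → ℚ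
∑ []       g = 0ℚ
∑ (a ∷ as) g = g a + ∑ as g

infixr 6.5 ∑
syntax ∑ xs (λ x → e) = ∑[ x ← xs ] e

module _ {A : Set} where

  ∑-cong : ∀ (xs : List A) {g h} → (∀ a → g a ≡ h a) → ∑ xs g ≡ ∑ xs h
  ∑-cong []       g≡h = refl
  ∑-cong (a ∷ xs) g≡h = cong₂ _+_ (g≡h a) (∑-cong xs g≡h)

  ∑-mono-≤ : ∀ (xs : List A) {g h} → (∀ a → g a ℚ.≤ h a) → ∑ xs g ℚ.≤ ∑ xs h
  ∑-mono-≤ []       g≤h = ℚₚ.≤-refl
  ∑-mono-≤ (a ∷ xs) g≤h = ℚₚ.+-mono-≤ (g≤h a) (∑-mono-≤ xs g≤h)

  ∑-++ : ∀ (xs ys : List A) g → ∑ (xs ++ ys) g ≡ ∑ xs g + ∑ ys g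
  ∑-++ []       ys g = sym (ℚₚ.+-identityˡ _)
  ∑-++ (a ∷ xs) ys g = trans (cong (g a +_) (∑-++ xs ys g)) (sym (ℚₚ.+-assoc (g a) _ _))

  ∑-distrib-+ : ∀ (xs : List A) g h → ∑[ a ← xs ] (g a + h a) ≡ ∑ xs g + ∑ xs h
  ∑-distrib-+ []       g h = refl
  ∑-distrib-+ (a ∷ xs) g h = trans (cong (g a + h a +_) (∑-distrib-+ xs g h))
    (solve 4 (λ p q r s → (p :+ q) :+ (r :+ s) := (p :+ r) :+ (q :+ s)) refl (g a) (h a) (∑ xs g) (∑ xs h))

  ∑-*ˡ : ∀ (xs : List A) c g → ∑[ a ← xs ] (c * g a) ≡ c * ∑ xs g
  ∑-*ˡ []       c g = sym (ℚₚ.*-zeroʳ c)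
  ∑-*ˡ (a ∷ xs) c g = trans (cong (c * g a +_) (∑-*ˡ xs c g)) (sym (ℚₚ.*-distribˡ-+ c (g a) _))

  ∑-const : ∀ (xs : List A) c → ∑[ a ← xs ] c ≡ ℕ→ℚ (length xs) * c
  ∑-const []       c = sym (ℚₚ.*-zeroˡ c)
  ∑-const (a ∷ xs) c = begin
    c + ∑[ a ← xs ] c                ≡⟨ cong (c +_) (∑-const xs c) ⟩
    c + ℕ→ℚ (length xs) * c         ≡⟨ solve 2 (λ c l → c :+ l :* c := (con 1ℚ :+ l) :* c) refl c (ℕ→ℚ (length xs)) ⟩
    (1ℚ + ℕ→ℚ (length xs)) * c      ≡⟨ cong (_* c) (sym (ℕ→ℚ-suc (length xs))) ⟩
    ℕ→ℚ (length (a ∷ xs)) * c       ∎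
    where open ≡-Reasoning

  ∑-zero : ∀ (xs : List A) → ∑[ a ← xs ] 0ℚ ≡ 0ℚ
  ∑-zero xs = trans (∑-const xs 0ℚ) (ℚₚ.*-zeroʳ (ℕ→ℚ (length xs)))

  ∑-*-zeroʳ : ∀ (xs : List A) (g : A → ℚ) → ∑[ a ← xs ] g a * 0ℚ ≡ 0ℚ
  ∑-*-zeroʳ xs g = trans (∑-cong xs (λ a → ℚₚ.*-zeroʳ (g a))) (∑-zero xs)

  ∑-affine : ∀ (xs : List A) c g d → ∑[ a ← xs ] (c * g a + d) ≡ c * ∑ xs g + ℕ→ℚ (length xs) * d
  ∑-affine xs c g d = trans (∑-distrib-+ xs (λ a → c * g a) (λ _ → d)) (cong₂ _+_ (∑-*ˡ xs c g) (∑-const xs d))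

module _ {A B : Set} where

  ∑-map : ∀ (xs : List A) (h : A → B) g → ∑ (map h xs) g ≡ ∑[ a ← xs ] g (h a)
  ∑-map []       h g = refl
  ∑-map (a ∷ xs) h g = cong (g (h a) +_) (∑-map xs h g)

  ∑-concatMap : ∀ (xs : List A) (h : A → List B) g → ∑ (concatMap h xs) g ≡ ∑[ a ← xs ] ∑ (h a) g
  ∑-concatMap []       h g = refl
  ∑-concatMap (a ∷ xs) h g = trans (∑-++ (h a) (concatMap h xs) g) (cong (∑ (h a) g +_) (∑-concatMap xs h g))

  ∑-comm : ∀ (xs : List A) (ys : List B) (g : A → B → ℚ) → ∑[ a ← xs ] ∑[ b ← ys ] g a b ≡ ∑[ b ← ys ] ∑[ a ← xs ] g a b
  ∑-comm []       ys g = sym (∑-zero ys)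
  ∑-comm (a ∷ xs) ys g = trans (cong (∑ ys (g a) +_) (∑-comm xs ys g)) (sym (∑-distrib-+ ys (g a) _))

∑-allSeqs-suc : ∀ {A : Set} m (xs : List A) g →
  ∑ (allSeqs (suc m) xs) g ≡ ∑[ x ← xs ] ∑[ ys ← allSeqs m xs ] g (x ∷ ys)
∑-allSeqs-suc m xs g = trans (∑-concatMap xs (λ x → map (x ∷_) (allSeqs m xs)) g)
  (∑-cong xs (λ x → ∑-map (allSeqs m xs) (x ∷_) g))

length-allSeqs : ∀ {A : Set} m (xs : List A) → length (allSeqs m xs) ≡ length xs ^ m
length-allSeqs zero    xs = refl
length-allSeqs (suc m) xs = trans (length-prefixed xs) (cong (length xs ℕ.*_) (length-allSeqs m xs))
  where
  length-prefixed : ∀ zs → length (concatMap (λ z → map (z ∷_) (allSeqs m xs)) zs) ≡ length zs ℕ.* length (allSeqs m xs)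
  length-prefixed []       = refl
  length-prefixed (z ∷ zs) = trans (length-++ (map (z ∷_) (allSeqs m xs)))
    (cong₂ ℕ._+_ (length-map (z ∷_) (allSeqs m xs)) (length-prefixed zs))

∑-^ℚ-odd-bound : ∀ {A : Set} i (xs : List A) (g : A → ℚ) {B} → (∀ a → g a ℚ.≤ B) →
  ∑[ a ← xs ] g a ^ℚ suc (suc (suc (2 ℕ.* i))) ℚ.≤ B ^ℚ suc (2 ℕ.* i) * (∑[ a ← xs ] g a * g a)
∑-^ℚ-odd-bound i xs g {B} g≤B =
  ℚₚ.≤-trans (∑-mono-≤ xs pointwise) (ℚₚ.≤-reflexive (∑-*ˡ xs (B ^ℚ j) (λ a → g a * g a)))
  where
  j = suc (2 ℕ.* i)
  pointwise : ∀ a → g a ^ℚ suc (suc j) ℚ.≤ B ^ℚ j * (g a * g a)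
  pointwise a = subst (ℚ._≤ B ^ℚ j * (g a * g a)) (solve 2 (λ c p → p :* (c :* c) := c :* (c :* p)) refl (g a) (g a ^ℚ j))
    (ℚₚ.*-monoʳ-≤-nonNeg (g a * g a) {{square-nonNeg (g a)}} (^ℚ-odd-mono-≤ i (g≤B a)))

⨁ : ∀ {n m} → Vec (Bits n) m → Bits n
⨁ = foldr _ _⊕_ 𝟎

⊕-identityʳ : ∀ {n} (x : Bits n) → x ⊕ 𝟎 ≡ x
⊕-identityʳ []          = refl
⊕-identityʳ (false ∷ x) = cong (false ∷_) (⊕-identityʳ x)
⊕-identityʳ (true ∷ x)  = cong (true ∷_) (⊕-identityʳ x)

linear-⊕ : ∀ {n} (S x y : Bits n) → linear S (x ⊕ y) ≡ linear S x xor linear S y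
linear-⊕ []      []      []      = refl
linear-⊕ (s ∷ S) (a ∷ x) (b ∷ y) = trans
  (cong₂ _xor_ (∧-distribˡ-xor s a b) (linear-⊕ S x y))
  (xor-interchange (s ∧ a) (s ∧ b) (linear S x) (linear S y))

linear-𝟎 : ∀ {n} (S : Bits n) → linear S 𝟎 ≡ false
linear-𝟎 []      = refl
linear-𝟎 (s ∷ S) rewrite ∧-zeroʳ s = linear-𝟎 S

length-allBits : ∀ n → length (allBits n) ≡ 2 ^ n
length-allBits n = length-allSeqs n (false ∷ true ∷ [])

∑-allBits-suc : ∀ n g → ∑ (allBits (suc n)) g ≡ ∑[ x ← allBits n ] g (false ∷ x) + ∑[ x ← allBits n ] g (true ∷ x)
∑-allBits-suc n g = trans (∑-allSeqs-suc n (false ∷ true ∷ []) g) (cong (∑[ x ← allBits n ] g (false ∷ x) +_) (ℚₚ.+-identityʳ _))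

sgn : Bool → ℚ
sgn false = 1ℚ
sgn true  = - 1ℚ

sgn-xor : ∀ a b → sgn (a xor b) ≡ sgn a * sgn b
sgn-xor false false = refl
sgn-xor false true  = refl
sgn-xor true  false = refl
sgn-xor true  true  = refl

sgn² : ∀ b → sgn b * sgn b ≡ 1ℚ
sgn² false = refl
sgn² true  = refl

χ : ∀ {n} → Bits n → Bits n → ℚ
χ S x = sgn (linear S x)

χ-⊕ : ∀ {n} (S x y : Bits n) → χ S (x ⊕ y) ≡ χ S x * χ S y
χ-⊕ S x y = trans (cong sgn (linear-⊕ S x y)) (sgn-xor (linear S x) (linear S y))

χ-𝟎 : ∀ {n} (S : Bits n) → χ S 𝟎 ≡ 1ℚ
χ-𝟎 S = cong sgn (linear-𝟎 S)

δ : ∀ {n} → Bits n → ℚ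
δ []          = 1ℚ
δ (false ∷ z) = δ z
δ (true ∷ z)  = 0ℚ

∑-χ : ∀ n (z : Bits n) → ∑[ S ← allBits n ] χ S z ≡ ℕ→ℚ (2 ^ n) * δ z
∑-χ zero    []          = refl
∑-χ (suc n) (false ∷ z) = begin
  ∑[ S ← allBits (suc n) ] χ S (false ∷ z)            ≡⟨ ∑-allBits-suc n (λ S → χ S (false ∷ z)) ⟩
  ∑[ S ← allBits n ] χ S z + ∑[ S ← allBits n ] χ S z ≡⟨ cong₂ _+_ (∑-χ n z) (∑-χ n z) ⟩
  ℕ→ℚ (2 ^ n) * δ z + ℕ→ℚ (2 ^ n) * δ z               ≡⟨ ℚₚ.*-distribʳ-+ (δ z) (ℕ→ℚ (2 ^ n)) _ ⟨
  (ℕ→ℚ (2 ^ n) + ℕ→ℚ (2 ^ n)) * δ z                   ≡⟨ cong (_* δ z) (ℕ→ℚ-2^-suc n) ⟨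
  ℕ→ℚ (2 ^ suc n) * δ z                               ∎
  where open ≡-Reasoning
∑-χ (suc n) (true ∷ z)  = begin
  ∑[ S ← allBits (suc n) ] χ S (true ∷ z)                   ≡⟨ ∑-allBits-suc n (λ S → χ S (true ∷ z)) ⟩
  ∑[ S ← allBits n ] χ S z + ∑[ S ← allBits n ] sgn (true xor linear S z)
    ≡⟨ cong (∑[ S ← allBits n ] χ S z +_) (trans (∑-cong (allBits n) (λ S → sgn-xor true (linear S z))) (∑-*ˡ (allBits n) (- 1ℚ) _)) ⟩
  ∑[ S ← allBits n ] χ S z + - 1ℚ * (∑[ S ← allBits n ] χ S z)
    ≡⟨ solve 2 (λ s N → s :+ (:- con 1ℚ) :* s := N :* con 0ℚ) refl (∑[ S ← allBits n ] χ S z) (ℕ→ℚ (2 ^ suc n)) ⟩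
  ℕ→ℚ (2 ^ suc n) * 0ℚ                                      ∎
  where open ≡-Reasoning

∑-δ : ∀ n (g : Bits n → ℚ) y → ∑[ x ← allBits n ] g x * δ (x ⊕ y) ≡ g y
∑-δ zero    g []          = solve 1 (λ a → a :* con 1ℚ :+ con 0ℚ := a) refl (g [])
∑-δ (suc n) g (false ∷ y) = begin
  ∑[ x ← allBits (suc n) ] g x * δ (x ⊕ (false ∷ y))
    ≡⟨ ∑-allBits-suc n (λ x → g x * δ (x ⊕ (false ∷ y))) ⟩
  ∑[ x ← allBits n ] g (false ∷ x) * δ (x ⊕ y) + ∑[ x ← allBits n ] g (true ∷ x) * 0ℚ
    ≡⟨ cong₂ _+_ (∑-δ n (λ x → g (false ∷ x)) y) (∑-*-zeroʳ (allBits n) (λ x → g (true ∷ x))) ⟩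
  g (false ∷ y) + 0ℚ
    ≡⟨ ℚₚ.+-identityʳ _ ⟩
  g (false ∷ y) ∎
  where open ≡-Reasoning
∑-δ (suc n) g (true ∷ y)  = begin
  ∑[ x ← allBits (suc n) ] g x * δ (x ⊕ (true ∷ y))
    ≡⟨ ∑-allBits-suc n (λ x → g x * δ (x ⊕ (true ∷ y))) ⟩
  ∑[ x ← allBits n ] g (false ∷ x) * 0ℚ + ∑[ x ← allBits n ] g (true ∷ x) * δ (x ⊕ y)
    ≡⟨ cong₂ _+_ (∑-*-zeroʳ (allBits n) (λ x → g (false ∷ x))) (∑-δ n (λ x → g (true ∷ x)) y) ⟩
  0ℚ + g (true ∷ y)
    ≡⟨ ℚₚ.+-identityˡ _ ⟩
  g (true ∷ y) ∎
  where open ≡-Reasoning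

module Fourier {n : ℕ} (F : Bits n → ℚ) where

  N : ℚ
  N = ℕ→ℚ (2 ^ n)

  -- Unnormalised: coeff S is 2ⁿ times the Fourier coefficient F̂(S).
  coeff : Bits n → ℚ
  coeff S = ∑[ x ← allBits n ] F x * χ S x

  inversion : ∀ y → ∑[ S ← allBits n ] coeff S * χ S y ≡ N * F y
  inversion y = begin
    ∑[ S ← allBits n ] coeff S * χ S y
      ≡⟨ ∑-cong (allBits n) (λ S → trans (ℚₚ.*-comm (coeff S) (χ S y)) (sym (∑-*ˡ (allBits n) (χ S y) (λ x → F x * χ S x)))) ⟩
    ∑[ S ← allBits n ] ∑[ x ← allBits n ] χ S y * (F x * χ S x)
      ≡⟨ ∑-cong (allBits n) (λ S → ∑-cong (allBits n) (λ x → character-shift S x)) ⟩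
    ∑[ S ← allBits n ] ∑[ x ← allBits n ] F x * χ S (x ⊕ y)
      ≡⟨ ∑-comm (allBits n) (allBits n) (λ S x → F x * χ S (x ⊕ y)) ⟩
    ∑[ x ← allBits n ] ∑[ S ← allBits n ] F x * χ S (x ⊕ y)
      ≡⟨ ∑-cong (allBits n) (λ x → trans (∑-*ˡ (allBits n) (F x) (λ S → χ S (x ⊕ y))) (cong (F x *_) (∑-χ n (x ⊕ y)))) ⟩
    ∑[ x ← allBits n ] F x * (N * δ (x ⊕ y))
      ≡⟨ ∑-cong (allBits n) (λ x → solve 3 (λ f a d → f :* (a :* d) := a :* (f :* d)) refl (F x) N (δ (x ⊕ y))) ⟩
    ∑[ x ← allBits n ] N * (F x * δ (x ⊕ y))
      ≡⟨ ∑-*ˡ (allBits n) N (λ x → F x * δ (x ⊕ y)) ⟩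
    N * (∑[ x ← allBits n ] F x * δ (x ⊕ y))
      ≡⟨ cong (N *_) (∑-δ n F y) ⟩
    N * F y ∎
    where
    open ≡-Reasoning
    character-shift : ∀ S x → χ S y * (F x * χ S x) ≡ F x * χ S (x ⊕ y)
    character-shift S x = trans (solve 3 (λ a b c → a :* (b :* c) := b :* (c :* a)) refl (χ S y) (F x) (χ S x))
                                (cong (F x *_) (sym (χ-⊕ S x y)))

  ∏ : ∀ {m} → Vec (Bits n) m → ℚ
  ∏ = foldr _ (λ x p → F x * p) 1ℚ

  corr : ℕ → (Bits n → ℚ) → ℚ
  corr m G = ∑[ xs ← allSeqs m (allBits n) ] ∏ xs * G (⨁ xs)

  corr-zero : ∀ G → corr 0 G ≡ G 𝟎
  corr-zero G = solve 1 (λ a → con 1ℚ :* a :+ con 0ℚ := a) refl (G 𝟎)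

  corr-suc : ∀ m G → corr (suc m) G ≡ ∑[ x ← allBits n ] F x * corr m (λ y → G (x ⊕ y))
  corr-suc m G = trans (∑-allSeqs-suc m (allBits n) (λ xs → ∏ xs * G (⨁ xs))) (∑-cong (allBits n) (λ x →
    trans (∑-cong (allSeqs m (allBits n)) (λ xs → ℚₚ.*-assoc (F x) (∏ xs) (G (x ⊕ ⨁ xs))))
          (∑-*ˡ (allSeqs m (allBits n)) (F x) (λ xs → ∏ xs * G (x ⊕ ⨁ xs)))))

  corr-cong : ∀ m {G H} → (∀ y → G y ≡ H y) → corr m G ≡ corr m H
  corr-cong m G≡H = ∑-cong (allSeqs m (allBits n)) (λ xs → cong (∏ xs *_) (G≡H (⨁ xs)))

  corr-*ˡ : ∀ m c G → corr m (λ y → c * G y) ≡ c * corr m G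
  corr-*ˡ m c G = trans
    (∑-cong (allSeqs m (allBits n)) (λ xs → solve 3 (λ p c g → p :* (c :* g) := c :* (p :* g)) refl (∏ xs) c (G (⨁ xs))))
    (∑-*ˡ (allSeqs m (allBits n)) c (λ xs → ∏ xs * G (⨁ xs)))

  corr-∑ : ∀ m (H : Bits n → Bits n → ℚ) → corr m (λ y → ∑[ S ← allBits n ] H S y) ≡ ∑[ S ← allBits n ] corr m (H S)
  corr-∑ m H = trans
    (∑-cong (allSeqs m (allBits n)) (λ xs → sym (∑-*ˡ (allBits n) (∏ xs) (λ S → H S (⨁ xs)))))
    (∑-comm (allSeqs m (allBits n)) (allBits n) (λ xs S → ∏ xs * H S (⨁ xs)))

  corr-χ : ∀ m S → corr m (χ S) ≡ coeff S ^ℚ m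
  corr-χ zero    S = trans (corr-zero (χ S)) (χ-𝟎 S)
  corr-χ (suc m) S = begin
    corr (suc m) (χ S)
      ≡⟨ corr-suc m (χ S) ⟩
    ∑[ x ← allBits n ] F x * corr m (λ y → χ S (x ⊕ y))
      ≡⟨ ∑-cong (allBits n) (λ x → cong (F x *_) (shifted x)) ⟩
    ∑[ x ← allBits n ] F x * (χ S x * coeff S ^ℚ m)
      ≡⟨ ∑-cong (allBits n) (λ x → solve 3 (λ f c p → f :* (c :* p) := p :* (f :* c)) refl (F x) (χ S x) (coeff S ^ℚ m)) ⟩
    ∑[ x ← allBits n ] coeff S ^ℚ m * (F x * χ S x)
      ≡⟨ ∑-*ˡ (allBits n) (coeff S ^ℚ m) (λ x → F x * χ S x) ⟩
    coeff S ^ℚ m * coeff S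
      ≡⟨ ℚₚ.*-comm (coeff S ^ℚ m) (coeff S) ⟩
    coeff S ^ℚ suc m ∎
    where
    open ≡-Reasoning
    shifted : ∀ x → corr m (λ y → χ S (x ⊕ y)) ≡ χ S x * coeff S ^ℚ m
    shifted x = trans (corr-cong m (χ-⊕ S x)) (trans (corr-*ˡ m (χ S x) (χ S)) (cong (χ S x *_) (corr-χ m S)))

  corr-self : ∀ m → N * corr m F ≡ ∑[ S ← allBits n ] coeff S ^ℚ suc m
  corr-self m = begin
    N * corr m F                                      ≡⟨ corr-*ˡ m N F ⟨
    corr m (λ y → N * F y)                            ≡⟨ corr-cong m (λ y → sym (inversion y)) ⟩
    corr m (λ y → ∑[ S ← allBits n ] coeff S * χ S y) ≡⟨ corr-∑ m (λ S y → coeff S * χ S y) ⟩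
    ∑[ S ← allBits n ] corr m (λ y → coeff S * χ S y)
      ≡⟨ ∑-cong (allBits n) (λ S → trans (corr-*ˡ m (coeff S) (χ S)) (cong (coeff S *_) (corr-χ m S))) ⟩
    ∑[ S ← allBits n ] coeff S ^ℚ suc m               ∎
    where open ≡-Reasoning

  parseval : (∀ x → F x * F x ≡ 1ℚ) → ∑[ S ← allBits n ] coeff S * coeff S ≡ N * N
  parseval F² = begin
    ∑[ S ← allBits n ] coeff S * coeff S
      ≡⟨ ∑-cong (allBits n) (λ S → cong (coeff S *_) (sym (ℚₚ.*-identityʳ (coeff S)))) ⟩
    ∑[ S ← allBits n ] coeff S ^ℚ 2    ≡⟨ corr-self 1 ⟨
    N * corr 1 F                       ≡⟨ cong (N *_) corr-one ⟩
    N * N                              ∎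
    where
    open ≡-Reasoning
    corr-one : corr 1 F ≡ N
    corr-one = begin
      corr 1 F                                           ≡⟨ corr-suc 0 F ⟩
      ∑[ x ← allBits n ] F x * corr 0 (λ y → F (x ⊕ y))
        ≡⟨ ∑-cong (allBits n) (λ x → trans (cong (F x *_) (trans (corr-zero (λ y → F (x ⊕ y))) (cong F (⊕-identityʳ x)))) (F² x)) ⟩
      ∑[ x ← allBits n ] 1ℚ                              ≡⟨ ∑-const (allBits n) 1ℚ ⟩
      ℕ→ℚ (length (allBits n)) * 1ℚ                      ≡⟨ ℚₚ.*-identityʳ _ ⟩
      ℕ→ℚ (length (allBits n))                           ≡⟨ cong ℕ→ℚ (length-allBits n) ⟩
      N                                                  ∎

  corr-bound : (∀ x → F x * F x ≡ 1ℚ) → ∀ {r} → (∀ S → coeff S ℚ.≤ r * N) → ∀ i →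
               corr (suc (suc (2 ℕ.* i))) F ℚ.≤ r ^ℚ suc (2 ℕ.* i) * N ^ℚ suc (suc (2 ℕ.* i))
  corr-bound F² {r} coeff≤ i = ℚₚ.*-cancelˡ-≤-pos N {{ℚ.positive (ℕ→ℚ-2^-pos n)}} (begin
    N * corr m F                                           ≡⟨ corr-self m ⟩
    ∑[ S ← allBits n ] coeff S ^ℚ suc m                    ≤⟨ ∑-^ℚ-odd-bound i (allBits n) coeff coeff≤ ⟩
    (r * N) ^ℚ j * (∑[ S ← allBits n ] coeff S * coeff S) ≡⟨ cong₂ _*_ (^ℚ-distrib-* r N j) (parseval F²) ⟩
    r ^ℚ j * N ^ℚ j * (N * N)
      ≡⟨ solve 3 (λ a p N → (a :* p) :* (N :* N) := N :* (a :* (N :* p))) refl (r ^ℚ j) (N ^ℚ j) N ⟩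
    N * (r ^ℚ j * N ^ℚ m)                                  ∎)
    where
    open ℚₚ.≤-Reasoning
    j = suc (2 ℕ.* i)
    m = suc j

𝟙 : ∀ {ℓ} {P : Set ℓ} → Dec P → ℚ
𝟙 (yes _) = 1ℚ
𝟙 (no _)  = 0ℚ

ℕ→ℚ-length-filter : ∀ {A : Set} {ℓ} {P : Pred A ℓ} (P? : Decidable P) xs →
                    ℕ→ℚ (length (filter P? xs)) ≡ ∑[ a ← xs ] 𝟙 (P? a)
ℕ→ℚ-length-filter P? []       = refl
ℕ→ℚ-length-filter P? (a ∷ xs) with P? a
... | yes _ = trans (ℕ→ℚ-suc (length (filter P? xs))) (cong (1ℚ +_) (ℕ→ℚ-length-filter P? xs))
... | no  _ = trans (ℕ→ℚ-length-filter P? xs) (sym (ℚₚ.+-identityˡ _))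

sgn-xor-agree : ∀ a b → sgn (a xor b) ≡ ℕ→ℚ 2 * 𝟙 (a ≟ b) + - 1ℚ
sgn-xor-agree false false = refl
sgn-xor-agree false true  = refl
sgn-xor-agree true  false = refl
sgn-xor-agree true  true  = refl

sgn-xor-disagree : ∀ a b → sgn (a xor b) ≡ - ℕ→ℚ 2 * 𝟙 (¬? (a ≟ b)) + 1ℚ
sgn-xor-disagree false false = refl
sgn-xor-disagree false true  = refl
sgn-xor-disagree true  false = refl
sgn-xor-disagree true  true  = refl

module _ {n : ℕ} (f : Bits n → Bool) where

  F : Bits n → ℚ
  F x = sgn (f x)

  open Fourier F

  ⨁f : ∀ {m} → Vec (Bits n) m → Bool
  ⨁f = foldr _ (λ x b → f x xor b) false

  ∏-sgn : ∀ {m} (xs : Vec (Bits n) m) → ∏ xs ≡ sgn (⨁f xs)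
  ∏-sgn []       = refl
  ∏-sgn (x ∷ xs) = trans (cong (F x *_) (∏-sgn xs)) (sym (sgn-xor (f x) (⨁f xs)))

  goodTuples-corr : ∀ m → ℕ→ℚ (goodTuples n m f) ≡ ½ * (corr m F + N ^ℚ m)
  goodTuples-corr m = begin
    G                                      ≡⟨ solve 2 (λ g M → g := con ½ :* ((con (ℕ→ℚ 2) :* g :+ M :* con (- 1ℚ)) :+ M)) refl G (N ^ℚ m) ⟩
    ½ * (ℕ→ℚ 2 * G + N ^ℚ m * - 1ℚ + N ^ℚ m) ≡⟨ cong (λ c → ½ * (c + N ^ℚ m)) corr≡ ⟨
    ½ * (corr m F + N ^ℚ m)                ∎
    where
    open ≡-Reasoning
    tuples = allSeqs m (allBits n)
    agree? = λ (xs : Vec (Bits n) m) → ⨁f xs ≟ f (⨁ xs)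
    G = ℕ→ℚ (goodTuples n m f)
    length-tuples : ℕ→ℚ (length tuples) ≡ N ^ℚ m
    length-tuples = trans (cong ℕ→ℚ (trans (length-allSeqs m (allBits n)) (cong (_^ m) (length-allBits n))))
                          (ℕ→ℚ-^ (2 ^ n) m)
    corr≡ : corr m F ≡ ℕ→ℚ 2 * G + N ^ℚ m * - 1ℚ
    corr≡ = begin
      corr m F
        ≡⟨ ∑-cong tuples (λ xs → trans (cong (_* F (⨁ xs)) (∏-sgn xs))
                                      (trans (sym (sgn-xor (⨁f xs) (f (⨁ xs)))) (sgn-xor-agree (⨁f xs) (f (⨁ xs))))) ⟩
      ∑[ xs ← tuples ] (ℕ→ℚ 2 * 𝟙 (agree? xs) + - 1ℚ)
        ≡⟨ ∑-affine tuples (ℕ→ℚ 2) (λ xs → 𝟙 (agree? xs)) (- 1ℚ) ⟩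
      ℕ→ℚ 2 * (∑[ xs ← tuples ] 𝟙 (agree? xs)) + ℕ→ℚ (length tuples) * - 1ℚ
        ≡⟨ cong₂ (λ g l → ℕ→ℚ 2 * g + l * - 1ℚ) (sym (ℕ→ℚ-length-filter agree? tuples)) length-tuples ⟩
      ℕ→ℚ 2 * G + N ^ℚ m * - 1ℚ ∎

  coeff-sgn : ∀ S → coeff S ≡ - ℕ→ℚ 2 * ℕ→ℚ (distance f (linear S)) + N
  coeff-sgn S = begin
    coeff S
      ≡⟨ ∑-cong (allBits n) (λ x → trans (sym (sgn-xor (f x) (linear S x))) (sgn-xor-disagree (f x) (linear S x))) ⟩
    ∑[ x ← allBits n ] (- ℕ→ℚ 2 * 𝟙 (disagree? x) + 1ℚ)
      ≡⟨ ∑-affine (allBits n) (- ℕ→ℚ 2) (λ x → 𝟙 (disagree? x)) 1ℚ ⟩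
    - ℕ→ℚ 2 * (∑[ x ← allBits n ] 𝟙 (disagree? x)) + ℕ→ℚ (length (allBits n)) * 1ℚ
      ≡⟨ cong₂ (λ d l → - ℕ→ℚ 2 * d + l) (sym (ℕ→ℚ-length-filter disagree? (allBits n)))
                                         (trans (ℚₚ.*-identityʳ _) (cong ℕ→ℚ (length-allBits n))) ⟩
    - ℕ→ℚ 2 * ℕ→ℚ (distance f (linear S)) + N ∎
    where
    open ≡-Reasoning
    disagree? = λ x → ¬? (f x ≟ linear S x)

  far⇒coeff≤ : ∀ {ε} → EpsFarFromLinear ε f → ∀ S → coeff S ℚ.≤ (1ℚ - ℕ→ℚ 2 * ε) * N
  far⇒coeff≤ {ε} far S = begin
    coeff S                                  ≡⟨ coeff-sgn S ⟩
    - ℕ→ℚ 2 * d + N                          ≡⟨ cong (_+ N) (ℚₚ.neg-distribˡ-* (ℕ→ℚ 2) d) ⟨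
    - (ℕ→ℚ 2 * d) + N                        ≤⟨ ℚₚ.+-monoˡ-≤ N (ℚₚ.neg-antimono-≤ (ℚₚ.*-monoˡ-≤-nonNeg (ℕ→ℚ 2) (far S))) ⟩
    - (ℕ→ℚ 2 * (ε * N)) + N                  ≡⟨ solve 2 (λ e N → :- (con (ℕ→ℚ 2) :* (e :* N)) :+ N := (con 1ℚ :- con (ℕ→ℚ 2) :* e) :* N) refl ε N ⟩
    (1ℚ - ℕ→ℚ 2 * ε) * N                     ∎
    where
    open ℚₚ.≤-Reasoning
    d = ℕ→ℚ (distance f (linear S))

  goodTuples-bound : ∀ {ε} → EpsFarFromLinear ε f → ∀ i →
    ℕ→ℚ (goodTuples n (suc (suc (2 ℕ.* i))) f)
      ℚ.≤ (½ + ½ * (1ℚ - ℕ→ℚ 2 * ε) ^ℚ suc (2 ℕ.* i)) * ℕ→ℚ (2 ^ (suc (suc (2 ℕ.* i)) ℕ.* n))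
  goodTuples-bound {ε} far i = begin
    ℕ→ℚ (goodTuples n m f)           ≡⟨ goodTuples-corr m ⟩
    ½ * (corr m F + N ^ℚ m)          ≤⟨ ℚₚ.*-monoˡ-≤-nonNeg ½ (ℚₚ.+-monoˡ-≤ (N ^ℚ m) (corr-bound (λ x → sgn² (f x)) {r} (far⇒coeff≤ {ε} far) i)) ⟩
    ½ * (r ^ℚ j * N ^ℚ m + N ^ℚ m)
      ≡⟨ solve 2 (λ a M → con ½ :* (a :* M :+ M) := (con ½ :+ con ½ :* a) :* M) refl (r ^ℚ j) (N ^ℚ m) ⟩
    (½ + ½ * r ^ℚ j) * N ^ℚ m        ≡⟨ cong ((½ + ½ * r ^ℚ j) *_) (ℕ→ℚ-2^-* m n) ⟨
    (½ + ½ * r ^ℚ j) * ℕ→ℚ (2 ^ (m ℕ.* n)) ∎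
    where
    open ℚₚ.≤-Reasoning
    j = suc (2 ℕ.* i)
    m = suc j
    r = 1ℚ - ℕ→ℚ 2 * ε

lemma26 : (n k : ℕ) → 1 ≤ k → (ε : ℚ) → 0ℚ < ε → (f : Bits n → Bool)
            → EpsFarFromLinear ε f
            → ℕ→ℚ (goodTuples n (Data.Nat._*_ 2 k) f)
              Data.Rational.≤ (½ + ½ * ((1ℚ - (ℕ→ℚ 2 * ε)) ^ℚ (Data.Nat._*_ 2 k ∸ 1)))
                              * ℕ→ℚ (Data.Nat._^_ 2 (Data.Nat._*_ (Data.Nat._*_ 2 k) n))
lemma26 n (suc i) _ ε _ f far =
  subst (λ m → ℕ→ℚ (goodTuples n m f) ℚ.≤ (½ + ½ * (1ℚ - ℕ→ℚ 2 * ε) ^ℚ (m ∸ 1)) * ℕ→ℚ (2 ^ (m ℕ.* n)))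
        (sym (ℕₚ.*-suc 2 i)) (goodTuples-bound f {ε} far i)
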